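{- Let $G$ be a graph and $\alpha=\{\alpha_i\}_{i=1}^t$, $\beta=\{\beta_i\}_{i=1}^t\subseteq V(G)$ such that every component of $G-\alpha$ intersects $\beta$. Suppose there exists an $(\alpha,\beta)$-rigid linkage $\mathcal{P}=\{p_i\}_{i=1}^t$ in which the endpoints of $p_i$ are $\alpha_i$ and $\beta_i$ with $\alpha_i\ne\beta_i$ for all $i$. Then there is a vertex $u\in\alpha$ such that $|N_G(u)\setminus\alpha|=1$.
   Context: $N_G(u)$ is the set of neighbors of $u$. A linkage in $G$ is a subgraph whose components are paths (a single vertex counts as a path). For $\alpha,\beta\subseteq V(G)$, a linkage is an $(\alpha,\beta)$-linkage if $\alpha$ consists of one endpoint of each path and $\beta$ of the other endpoints; it is $(\alpha,\beta)$-rigid if it is the unique $(\alpha,\beta)$-linkage in $G$. -}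

module Defs where

open import Data.Nat using (ℕ)
open import Data.Fin using (Fin)
open import Data.List using (List; []; _∷_)
open import Data.List.Relation.Unary.All using (All)
open import Data.List.Relation.Unary.Unique.Propositional using (Unique)
open import Data.List.Membership.Propositional using (_∈_; _∉_)
open import Data.Product using (Σ; ∃; _×_; _,_)
open import Data.Sum using (_⊎_)
open import Data.Empty using (⊥)
open import Relation.Nullary using (¬_; Dec)
open import Relation.Binary.PropositionalEquality using (_≡_; _≢_)
open import Function.Definitions using (Injective)

record Graph (n : ℕ) : Set₁ where
  field
    _~_      : Fin n → Fin n → Set
    ~-sym    : ∀ {u v} → u ~ v → v ~ u
    ~-irrefl : ∀ {u} → ¬ (u ~ u)
    ~-dec    : ∀ u v → Dec (u ~ v)

_∈ᵥ_ : ∀ {n t} → Fin n → (Fin t → Fin n) → Set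
v ∈ᵥ α = ∃ λ i → α i ≡ v

module _ {n : ℕ} (G : Graph n) where
  open Graph G

  data Walk : Fin n → Fin n → Set where
    [_]    : ∀ a → Walk a a
    _∷⟨_⟩_ : ∀ a {b c} → a ~ b → Walk b c → Walk a c

  verts : ∀ {a b} → Walk a b → List (Fin n)
  verts [ a ] = a ∷ []
  verts (a ∷⟨ _ ⟩ w) = a ∷ verts w

  usesEdge : ∀ {a b} → Walk a b → Fin n → Fin n → Set
  usesEdge [ a ] u v = ⊥
  usesEdge (_∷⟨_⟩_ a {b} _ w) u v =
    ((u ≡ a × v ≡ b) ⊎ (u ≡ b × v ≡ a)) ⊎ usesEdge w u v

  ComponentsMeet : ∀ {t s} → (Fin t → Fin n) → (Fin s → Fin n) → Set
  ComponentsMeet α β =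
    ∀ v → ¬ (v ∈ᵥ α) →
      ∃ λ j → Σ (Walk v (β j)) λ w → All (λ x → ¬ (x ∈ᵥ α)) (verts w)

  -- An (α,β)-linkage: vertex-disjoint paths, the i-th going from α i to β (σ i),
  -- with σ a bijection of Fin t (so α is exactly the set of one endpoints and
  -- β exactly the set of the other endpoints).
  record Linkage {t : ℕ} (α β : Fin t → Fin n) : Set where
    field
      σ        : Fin t → Fin t
      σ-inj    : Injective _≡_ _≡_ σ
      path     : (i : Fin t) → Walk (α i) (β (σ i))
      isPath   : ∀ i → Unique (verts (path i))
      disjoint : ∀ i j → i ≢ j → ∀ v → v ∈ verts (path i) → v ∉ verts (path j)

  module _ {t : ℕ} {α β : Fin t → Fin n} where
    InV : Linkage α β → Fin n → Set
    InV L v = ∃ λ i → v ∈ verts (Linkage.path L i)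

    InE : Linkage α β → Fin n → Fin n → Set
    InE L u v = ∃ λ i → usesEdge (Linkage.path L i) u v

    SameSubgraph : Linkage α β → Linkage α β → Set
    SameSubgraph L M =
      (∀ v → (InV L v → InV M v) × (InV M v → InV L v)) ×
      (∀ u v → (InE L u v → InE M u v) × (InE M u v → InE L u v))

    Rigid : Linkage α β → Set
    Rigid L = ∀ (M : Linkage α β) → SameSubgraph M L

  OneNeighbourOutside : ∀ {t} → (Fin t → Fin n) → Fin n → Set
  OneNeighbourOutside α u =
    ∃ λ v → (u ~ v) × ¬ (v ∈ᵥ α) ×
      (∀ w → u ~ w → ¬ (w ∈ᵥ α) → w ≡ v)

-- Suppose no α i has exactly one neighbour outside α. The second vertex of p i is one such
-- neighbour, so α i has another, w; the component of w in G - α meets β, hence P, so from α i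
-- there is a detour through w, avoiding P, onto some path p k after α k. Following detours from
-- path to path closes a cycle of indices. A shortest such cycle has pairwise distinct targets
-- and pairwise disjoint detours (two conflicting moves could be merged, skipping everything in
-- between), so rerouting every path of the cycle along its detour and the rest of the target
-- path gives another (α,β)-linkage. It uses the edge from α i to w, which is not in P,
-- contradicting rigidity.
module Submission where

open import Defs
open import Data.Nat using (ℕ; zero; suc; _+_; _≤_; _<_; s≤s)
open import Data.Nat.Properties using (≤-refl; m≤n⇒m≤1+n; n<1+n; +-suc; m≤n⇒∃[o]m+o≡n)
open import Data.Nat.GeneralisedArithmetic using (iterate)
open import Data.Nat.Induction using (<-wellFounded)
open import Induction.WellFounded using (Acc; acc)
open import Data.Fin using (Fin; toℕ; zero)
open import Data.Fin.Properties using (_≟_; any?; all?; ¬∀⟶∃¬; pigeonhole)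
open import Data.List using (List; []; _∷_; map; length)
open import Data.List.Relation.Unary.All using (All; []; _∷_)
import Data.List.Relation.Unary.All as All
open import Data.List.Relation.Unary.All.Properties.Core using (¬Any⇒All¬; All¬⇒¬Any)
open import Data.List.Relation.Unary.Any using (here; there)
import Data.List.Relation.Unary.Any as Any
open import Data.List.Relation.Unary.AllPairs.Core using (AllPairs; []; _∷_)
open import Data.List.Relation.Unary.Unique.Propositional using (Unique)
open import Data.List.Relation.Binary.Subset.Propositional using (_⊆_)
open import Data.List.Relation.Binary.Disjoint.Propositional using (Disjoint)
import Data.List.Relation.Binary.Disjoint.Propositional.Properties as Disjoint
open import Data.List.Membership.Propositional using (_∈_; _∉_; find; lose)
open import Data.List.Membership.Propositional.Properties using (∈-map⁻)
open import Data.Product using (Σ; ∃; ∃₂; _×_; _,_; proj₁; proj₂)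
import Data.Product as Product
open import Data.Sum using (_⊎_; inj₁; inj₂)
import Data.Sum as Sum
open import Data.Empty using (⊥; ⊥-elim)
open import Function using (_∘_; id)
open import Relation.Nullary using (¬_; Dec; yes; no)
open import Relation.Nullary.Decidable using (_×-dec_; ¬?)
open import Relation.Binary.Definitions using (DecidableEquality; Symmetric)
open import Relation.Binary.PropositionalEquality
  using (_≡_; _≢_; refl; sym; trans; subst; cong; ≢-sym; module ≡-Reasoning)

iterate-+ : ∀ {A : Set} (f : A → A) x a b → iterate f x (a + b) ≡ iterate f (iterate f x a) b
iterate-+ f x zero    b = refl
iterate-+ f x (suc a) b = iterate-+ f (f x) a b

periodicPoint : ∀ {t} (f : Fin t → Fin t) → Fin t → ∃₂ λ x m → iterate f x (suc m) ≡ x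
periodicPoint {t} f x₀ with pigeonhole (n<1+n t) (iterate f x₀ ∘ toℕ)
... | a , b , a<b , fa≡fb with m≤n⇒∃[o]m+o≡n a<b
...   | m , a+1+m≡b = iterate f x₀ (toℕ a) , m , periodic
  where
  open ≡-Reasoning
  periodic : iterate f (iterate f x₀ (toℕ a)) (suc m) ≡ iterate f x₀ (toℕ a)
  periodic = begin
    iterate f (iterate f x₀ (toℕ a)) (suc m) ≡⟨ iterate-+ f x₀ (toℕ a) (suc m) ⟨
    iterate f x₀ (toℕ a + suc m)             ≡⟨ cong (iterate f x₀) (trans (+-suc (toℕ a) m) a+1+m≡b) ⟩
    iterate f x₀ (toℕ b)                     ≡⟨ fa≡fb ⟨
    iterate f x₀ (toℕ a)                     ∎

allPairs-lookup : ∀ {A : Set} {R : A → A → Set} {xs a b} → Symmetric R →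
                  AllPairs R xs → a ∈ xs → b ∈ xs → a ≢ b → R a b
allPairs-lookup _     (_ ∷ _)  (here refl) (here refl) a≢b = ⊥-elim (a≢b refl)
allPairs-lookup _     (Ra ∷ _) (here refl) (there b∈)  _   = All.lookup Ra b∈
allPairs-lookup R-sym (Rb ∷ _) (there a∈) (here refl) _   = R-sym (All.lookup Rb a∈)
allPairs-lookup R-sym (_ ∷ Rs) (there a∈) (there b∈)  a≢b = allPairs-lookup R-sym Rs a∈ b∈ a≢b

module _ {A : Set} (_≟ᴬ_ : DecidableEquality A) where
  open import Data.List.Membership.DecPropositional _≟ᴬ_ using (_∈?_)

  commonElement : (xs ys : List A) → (∃ λ v → v ∈ xs × v ∈ ys) ⊎ Disjoint xs ys
  commonElement xs ys with Any.any? (_∈? ys) xs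
  ... | yes v∈ys = inj₁ (find v∈ys)
  ... | no ¬v∈ys = inj₂ λ (v∈xs , v∈ys) → ¬v∈ys (lose v∈xs v∈ys)

module WalkProperties {n : ℕ} (G : Graph n) where
  open Graph G
  open import Data.List.Membership.DecPropositional (_≟_ {n}) using (_∈?_)

  start-∈ : ∀ {a b} (w : Walk G a b) → a ∈ verts G w
  start-∈ [ a ]        = here refl
  start-∈ (a ∷⟨ _ ⟩ w) = here refl

  end-∈ : ∀ {a b} (w : Walk G a b) → b ∈ verts G w
  end-∈ [ a ]        = here refl
  end-∈ (a ∷⟨ _ ⟩ w) = there (end-∈ w)

  suffix : ∀ {a b z} (w : Walk G a b) → z ∈ verts G w → Walk G z b
  suffix [ a ]          (here refl) = [ a ]
  suffix (a ∷⟨ e ⟩ w) (here refl) = a ∷⟨ e ⟩ w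
  suffix (a ∷⟨ e ⟩ w) (there z∈w) = suffix w z∈w

  suffix-⊆ : ∀ {a b z} (w : Walk G a b) (z∈w : z ∈ verts G w) → verts G (suffix w z∈w) ⊆ verts G w
  suffix-⊆ [ a ]          (here refl) = λ v∈ → v∈
  suffix-⊆ (a ∷⟨ e ⟩ w) (here refl) = λ v∈ → v∈
  suffix-⊆ (a ∷⟨ e ⟩ w) (there z∈w) = there ∘ suffix-⊆ w z∈w

  start-∉-suffix : ∀ {a b z} (w : Walk G a b) (z∈w : z ∈ verts G w) →
                   Unique (verts G w) → z ≢ a → a ∉ verts G (suffix w z∈w)
  start-∉-suffix [ a ]          (here refl) _               z≢a = ⊥-elim (z≢a refl)
  start-∉-suffix (a ∷⟨ e ⟩ w) (here refl) _               z≢a = ⊥-elim (z≢a refl)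
  start-∉-suffix (a ∷⟨ e ⟩ w) (there z∈w) (a∉w ∷ _) _ a∈ =
    All¬⇒¬Any a∉w (suffix-⊆ w z∈w a∈)

  suffix-unique : ∀ {a b z} (w : Walk G a b) (z∈w : z ∈ verts G w) →
                  Unique (verts G w) → Unique (verts G (suffix w z∈w))
  suffix-unique [ a ]          (here refl) u       = u
  suffix-unique (a ∷⟨ e ⟩ w) (here refl) u       = u
  suffix-unique (a ∷⟨ e ⟩ w) (there z∈w) (_ ∷ u) = suffix-unique w z∈w u

  toPath : ∀ {a b} (w : Walk G a b) → Σ (Walk G a b) λ p → Unique (verts G p) × verts G p ⊆ verts G w
  toPath [ a ] = [ a ] , [] ∷ [] , λ v∈ → v∈
  toPath (a ∷⟨ e ⟩ w) with toPath w
  ... | p , unique , p⊆w with a ∈? verts G p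
  ...   | yes a∈p = suffix p a∈p , suffix-unique p a∈p unique , there ∘ p⊆w ∘ suffix-⊆ p a∈p
  ...   | no a∉p = (a ∷⟨ e ⟩ p) , ¬Any⇒All¬ _ a∉p ∷ unique
                 , λ { (here refl) → here refl ; (there v∈p) → there (p⊆w v∈p) }

  second : ∀ {a b} → Walk G a b → Fin n
  second [ a ]              = a
  second (_∷⟨_⟩_ _ {b} _ _) = b

  second-adj : ∀ {a b} (w : Walk G a b) → a ≢ b → a ~ second w
  second-adj [ a ]        a≢a = ⊥-elim (a≢a refl)
  second-adj (a ∷⟨ e ⟩ w) _   = e

  second-∈ : ∀ {a b} (w : Walk G a b) → second w ∈ verts G w
  second-∈ [ a ]        = here refl
  second-∈ (a ∷⟨ e ⟩ w) = there (start-∈ w)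

  second-≢ : ∀ {a b} (w : Walk G a b) → a ≢ b → Unique (verts G w) → second w ≢ a
  second-≢ [ a ]        a≢a _           = λ _ → a≢a refl
  second-≢ (a ∷⟨ e ⟩ w) _   (a∉w ∷ _) b≡a = All¬⇒¬Any a∉w (subst (_∈ verts G w) b≡a (start-∈ w))

  usesEdge-∈ : ∀ {a b u v} (w : Walk G a b) → usesEdge G w u v → u ∈ verts G w × v ∈ verts G w
  usesEdge-∈ (a ∷⟨ e ⟩ w) (inj₁ (inj₁ (refl , refl))) = here refl , there (start-∈ w)
  usesEdge-∈ (a ∷⟨ e ⟩ w) (inj₁ (inj₂ (refl , refl))) = there (start-∈ w) , here refl
  usesEdge-∈ (a ∷⟨ e ⟩ w) (inj₂ uses) with usesEdge-∈ w uses
  ... | u∈w , v∈w = there u∈w , there v∈w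

  usesEdge-start : ∀ {a b v} (w : Walk G a b) → Unique (verts G w) → usesEdge G w a v → v ≡ second w
  usesEdge-start (a ∷⟨ e ⟩ w) _         (inj₁ (inj₁ (_ , v≡b))) = v≡b
  usesEdge-start (a ∷⟨ e ⟩ w) (a∉w ∷ _) (inj₁ (inj₂ (a≡b , _))) =
    ⊥-elim (All¬⇒¬Any a∉w (subst (_∈ verts G w) (sym a≡b) (start-∈ w)))
  usesEdge-start (a ∷⟨ e ⟩ w) (a∉w ∷ _) (inj₂ uses) =
    ⊥-elim (All¬⇒¬Any a∉w (proj₁ (usesEdge-∈ w uses)))

module Neighbourhoods {n t : ℕ} (G : Graph n) (α : Fin t → Fin n) where
  open Graph G

  ∈ᵥ? : ∀ v → Dec (v ∈ᵥ α)
  ∈ᵥ? v = any? λ i → α i ≟ v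

  AnotherNeighbourOutside : Fin n → Fin n → Set
  AnotherNeighbourOutside u v = ∃ λ w → u ~ w × ¬ w ∈ᵥ α × w ≢ v

  anotherNeighbourOutside? : ∀ u v → Dec (AnotherNeighbourOutside u v)
  anotherNeighbourOutside? u v = any? λ w → ~-dec u w ×-dec ¬? (∈ᵥ? w) ×-dec ¬? (w ≟ v)

  oneNeighbourOutside : ∀ {u v} → u ~ v → ¬ v ∈ᵥ α → ¬ AnotherNeighbourOutside u v →
                        OneNeighbourOutside G α u
  oneNeighbourOutside {u} {v} u~v v∉α none = v , u~v , v∉α , onlyV
    where
    onlyV : ∀ w → u ~ w → ¬ w ∈ᵥ α → w ≡ v
    onlyV w u~w w∉α with w ≟ v
    ... | yes w≡v = w≡v
    ... | no w≢v  = ⊥-elim (none (w , u~w , w∉α , w≢v))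

module Rerouting {n t : ℕ} (G : Graph n) {α β : Fin t → Fin n}
  (meets : ComponentsMeet G α β) (P : Linkage G α β)
  (σ-id : ∀ i → Linkage.σ P i ≡ i) (nontrivial : ∀ i → α i ≢ β i) where

  open Graph G
  open Linkage P
  open WalkProperties G
  open Neighbourhoods G α
  open import Data.List.Membership.DecPropositional (_≟_ {n}) using (_∈?_)

  OnP : Fin n → Set
  OnP v = ∃ λ i → v ∈ verts G (path i)

  OffP : Fin n → Set
  OffP v = ¬ OnP v

  onP? : ∀ v → Dec (OnP v)
  onP? v = any? λ i → v ∈? verts G (path i)

  sameIndex : ∀ {i j v} → v ∈ verts G (path i) → v ∈ verts G (path j) → i ≡ j
  sameIndex {i} {j} v∈i v∈j with i ≟ j
  ... | yes i≡j = i≡j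
  ... | no i≢j  = ⊥-elim (disjoint i j i≢j _ v∈i v∈j)

  α-onP : ∀ i → OnP (α i)
  α-onP i = i , start-∈ (path i)

  β-onP : ∀ j → OnP (β j)
  β-onP j = j , subst (λ b → b ∈ verts G (path j)) (cong β (σ-id j)) (end-∈ (path j))

  α-injective : ∀ {i j} → α i ≡ α j → i ≡ j
  α-injective {i} {j} αi≡αj =
    sameIndex (start-∈ (path i)) (subst (_∈ verts G (path j)) (sym αi≡αj) (start-∈ (path j)))

  someIndex : Fin n → Fin t
  someIndex v with ∈ᵥ? v
  ... | yes (i , _) = i
  ... | no v∉α      = proj₁ (meets v v∉α)

  path-nontrivial : ∀ i → α i ≢ β (σ i)
  path-nontrivial i αi≡βσi = nontrivial i (trans αi≡βσi (cong β (σ-id i)))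

  next : Fin t → Fin n
  next i = second (path i)

  next-adj : ∀ i → α i ~ next i
  next-adj i = second-adj (path i) (path-nontrivial i)

  next-∉α : ∀ i → ¬ next i ∈ᵥ α
  next-∉α i (j , αj≡next)
    with sameIndex (subst (_∈ verts G (path j)) αj≡next (start-∈ (path j))) (second-∈ (path i))
  ... | refl = second-≢ (path i) (path-nontrivial i) (isPath i) (sym αj≡next)

  Tail : Fin t → Fin n → Set
  Tail k v = v ∈ verts G (path k) × v ≢ α k

  ¬tail-α : ∀ {x k} → ¬ Tail k (α x)
  ¬tail-α {x} (αx∈k , αx≢αk) = αx≢αk (cong α (sameIndex (start-∈ (path x)) αx∈k))

  suffix-tail : ∀ {k z v} (z∈k : z ∈ verts G (path k)) → z ≢ α k →
                v ∈ verts G (suffix (path k) z∈k) → Tail k v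
  suffix-tail {k} z∈k z≢αk v∈ =
    suffix-⊆ (path k) z∈k v∈ , λ { refl → start-∉-suffix (path k) z∈k (isPath k) z≢αk v∈ }

  data Detour (k : Fin t) : Fin n → Set where
    land : ∀ {z} → z ∈ verts G (path k) → z ≢ α k → Detour k z
    hop  : ∀ {w w′} → OffP w → w ~ w′ → Detour k w′ → Detour k w

  offs : ∀ {k w} → Detour k w → List (Fin n)
  offs (land _ _)      = []
  offs (hop {w} _ _ d) = w ∷ offs d

  offs-offP : ∀ {k w v} (d : Detour k w) → v ∈ offs d → OffP v
  offs-offP (hop w∉P _ _) (here refl) = w∉P
  offs-offP (hop _ _ d)   (there v∈d) = offs-offP d v∈d

  detourWalk : ∀ {k w} → Detour k w → Walk G w (β (σ k))
  detourWalk {k} (land z∈k _) = suffix (path k) z∈k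
  detourWalk (hop {w} _ e d)  = w ∷⟨ e ⟩ detourWalk d

  detourWalk-verts : ∀ {k w v} (d : Detour k w) → v ∈ verts G (detourWalk d) → v ∈ offs d ⊎ Tail k v
  detourWalk-verts (land z∈k z≢αk) v∈ = inj₂ (suffix-tail z∈k z≢αk v∈)
  detourWalk-verts (hop _ _ d) (here refl) = inj₁ (here refl)
  detourWalk-verts (hop _ _ d) (there v∈) = Sum.map₁ there (detourWalk-verts d v∈)

  α∉detourWalk : ∀ {x k w} (d : Detour k w) → α x ∉ verts G (detourWalk d)
  α∉detourWalk {x} d αx∈ with detourWalk-verts d αx∈
  ... | inj₁ αx∈offs = offs-offP d αx∈offs (α-onP x)
  ... | inj₂ tail    = ¬tail-α tail

  detourFrom : ∀ {k w v} (d : Detour k w) → v ∈ offs d → Detour k v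
  detourFrom (hop w∉P e d) (here refl) = hop w∉P e d
  detourFrom (hop _ _ d)   (there v∈d) = detourFrom d v∈d

  splice : ∀ {k k′ w w′ v} (d : Detour k w) (d′ : Detour k′ w′) → v ∈ offs d → v ∈ offs d′ → Detour k′ w
  splice (hop _ _ d)     d′ (here refl) v∈d′ = detourFrom d′ v∈d′
  splice (hop w∉P e d) d′ (there v∈d) v∈d′ = hop w∉P e (splice d d′ v∈d v∈d′)

  toDetour : ∀ {a b} (W : Walk G a b) → OnP b → All (λ v → ¬ v ∈ᵥ α) (verts G W) → ∃ λ k → Detour k a
  toDetour [ a ] (k , a∈k) (a∉α ∷ []) = k , land a∈k (a∉α ∘ (k ,_) ∘ sym)
  toDetour (a ∷⟨ e ⟩ W) b∈P (a∉α ∷ W∉α) with onP? a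
  ... | yes (k , a∈k) = k , land a∈k (a∉α ∘ (k ,_) ∘ sym)
  ... | no a∉P        = Product.map₂ (hop a∉P e) (toDetour W b∈P W∉α)

  data Step (x k : Fin t) : Set where
    step : ∀ {w} → α x ~ w → w ≢ next x → Detour k w → Step x k

  stepOffs : ∀ {x k} → Step x k → List (Fin n)
  stepOffs (step _ _ d) = offs d

  Fork : Fin t → Set
  Fork i = AnotherNeighbourOutside (α i) (next i)

  fork⇒step : ∀ {i} → Fork i → ∃ λ k → Step i k
  fork⇒step (w , αi~w , w∉α , w≢next) with meets w w∉α
  ... | j , W , W∉α = Product.map₂ (step αi~w w≢next) (toDetour W (β-onP j) W∉α)

  reroute : ∀ {x k} → Step x k → Walk G (α x) (β (σ k))
  reroute {x} (step αx~w _ d) = α x ∷⟨ αx~w ⟩ proj₁ (toPath (detourWalk d))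

  reroute-unique : ∀ {x k} (s : Step x k) → Unique (verts G (reroute s))
  reroute-unique (step _ _ d) =
    let _ , unique , ⊆walk = toPath (detourWalk d) in ¬Any⇒All¬ _ (α∉detourWalk d ∘ ⊆walk) ∷ unique

  RouteVertex : Fin t → Fin t → Fin n → Set
  RouteVertex x k v = v ≡ α x ⊎ Tail k v

  routeVertex-onP : ∀ {x k v} → RouteVertex x k v → OnP v
  routeVertex-onP {x} (inj₁ refl)      = α-onP x
  routeVertex-onP {k = k} (inj₂ (v∈k , _)) = k , v∈k

  routeVertices-disjoint : ∀ {x x′ k k′ v} → x ≢ x′ → k ≢ k′ → RouteVertex x k v → RouteVertex x′ k′ v → ⊥
  routeVertices-disjoint x≢x′ _ (inj₁ refl) (inj₁ αx≡αx′) = x≢x′ (α-injective αx≡αx′)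
  routeVertices-disjoint _ _ (inj₁ refl) (inj₂ tail) = ¬tail-α tail
  routeVertices-disjoint _ _ (inj₂ tail) (inj₁ refl) = ¬tail-α tail
  routeVertices-disjoint _ k≢k′ (inj₂ (v∈k , _)) (inj₂ (v∈k′ , _)) = k≢k′ (sameIndex v∈k v∈k′)

  path-verts : ∀ {x v} → v ∈ verts G (path x) → RouteVertex x x v
  path-verts {x} {v} v∈x with v ≟ α x
  ... | yes v≡αx = inj₁ v≡αx
  ... | no v≢αx  = inj₂ (v∈x , v≢αx)

  reroute-verts : ∀ {x k v} (s : Step x k) → v ∈ verts G (reroute s) → v ∈ stepOffs s ⊎ RouteVertex x k v
  reroute-verts (step _ _ d) (here v≡αx) = inj₂ (inj₁ v≡αx)
  reroute-verts (step _ _ d) (there v∈) =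
    Sum.map₂ inj₂ (detourWalk-verts d (proj₂ (proj₂ (toPath (detourWalk d))) v∈))

  fresh-edge : ∀ {x w} → w ≢ next x → ¬ InE G P (α x) w
  fresh-edge {x} w≢next (j , uses) with sameIndex (start-∈ (path x)) (proj₁ (usesEdge-∈ (path j) uses))
  ... | refl = w≢next (usesEdge-start (path x) (isPath x) uses)

  reroute-freshEdge : ∀ {x k} (s : Step x k) → ∃ λ w → usesEdge G (reroute s) (α x) w × ¬ InE G P (α x) w
  reroute-freshEdge (step {w} _ w≢next _) = w , inj₁ (inj₁ (refl , refl)) , fresh-edge w≢next

  record Move : Set where
    constructor ⟨_⟩
    field
      {from to} : Fin t
      move      : Step from to

  moveOffs : Move → List (Fin n)
  moveOffs m = stepOffs (Move.move m)

  record Compatible (m m′ : Move) : Set where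
    constructor compatible
    field
      to≢           : Move.to m ≢ Move.to m′
      offs-disjoint : Disjoint (moveOffs m) (moveOffs m′)

  compatible-sym : Symmetric Compatible
  compatible-sym (compatible to≢ disj) = compatible (≢-sym to≢) (Disjoint.sym disj)

  Conflict : ∀ {x k x′ k′} → Step x k → Step x′ k′ → Set
  Conflict {k = k} {k′ = k′} s s′ = k ≡ k′ ⊎ ∃ λ v → v ∈ stepOffs s × v ∈ stepOffs s′

  conflict? : ∀ {x k x′ k′} (s : Step x k) (s′ : Step x′ k′) → Conflict s s′ ⊎ Compatible ⟨ s ⟩ ⟨ s′ ⟩
  conflict? {k = k} {k′ = k′} s s′ with k ≟ k′ | commonElement _≟_ (stepOffs s) (stepOffs s′)
  ... | yes k≡k′ | _           = inj₁ (inj₁ k≡k′)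
  ... | no _     | inj₁ common = inj₁ (inj₂ common)
  ... | no k≢k′  | inj₂ disj   = inj₂ (compatible k≢k′ disj)

  merge : ∀ {x k x′ k′} (s : Step x k) (s′ : Step x′ k′) → Conflict s s′ → Step x k′
  merge s _ (inj₁ refl) = s
  merge (step αx~w w≢next d) (step _ _ d′) (inj₂ (_ , v∈d , v∈d′)) =
    step αx~w w≢next (splice d d′ v∈d v∈d′)

  data Chain : Fin t → Fin t → Set where
    []  : ∀ {i} → Chain i i
    _∷_ : ∀ {i j k} → Step i j → Chain j k → Chain i k

  moves : ∀ {i j} → Chain i j → List Move
  moves []      = []
  moves (s ∷ c) = ⟨ s ⟩ ∷ moves c

  starts : ∀ {i j} → Chain i j → List (Fin t)
  starts c = map Move.from (moves c)

  size : ∀ {i j} → Chain i j → ℕ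
  size c = length (moves c)

  Good : ∀ {i j} → Chain i j → Set
  Good c = AllPairs Compatible (moves c)

  to-∈-starts : ∀ {i j m} (c : Chain i j) → m ∈ moves c → Move.to m ∈ starts c ⊎ Move.to m ≡ j
  to-∈-starts (s ∷ [])      (here refl) = inj₂ refl
  to-∈-starts (s ∷ (_ ∷ _)) (here refl) = inj₁ (there (here refl))
  to-∈-starts (s ∷ c)       (there m∈c) = Sum.map₁ there (to-∈-starts c m∈c)

  shortcut : ∀ {x k i j} (s : Step x k) (c : Chain i j) →
             All (Compatible ⟨ s ⟩) (moves c) ⊎ Σ (Chain x j) λ c′ → x ∈ starts c′ × size c′ ≤ size c
  shortcut s []       = inj₁ []
  shortcut s (s′ ∷ c) with conflict? s s′
  ... | inj₁ conflict = inj₂ (merge s s′ conflict ∷ c , here refl , ≤-refl)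
  ... | inj₂ ok with shortcut s c
  ...   | inj₁ oks              = inj₁ (ok ∷ oks)
  ...   | inj₂ (c′ , x∈c′ , le) = inj₂ (c′ , x∈c′ , m≤n⇒m≤1+n le)

  reduce : ∀ {i j} (c : Chain i j) → Good c ⊎ Σ (Chain i j) λ c′ → i ∈ starts c′ × size c′ < size c
  reduce []      = inj₁ []
  reduce (s ∷ c) with reduce c
  ... | inj₂ (c′ , _ , shorter) = inj₂ (s ∷ c′ , here refl , s≤s shorter)
  ... | inj₁ good with shortcut s c
  ...   | inj₁ oks              = inj₁ (oks ∷ good)
  ...   | inj₂ (c′ , x∈c′ , le) = inj₂ (c′ , x∈c′ , s≤s le)

  reduceToGood : ∀ {i j} (c : Chain i j) → i ∈ starts c → Acc _<_ (size c) →
            Σ (Chain i j) λ c′ → i ∈ starts c′ × Good c′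
  reduceToGood c i∈c (acc smaller) with reduce c
  ... | inj₁ good                 = c , i∈c , good
  ... | inj₂ (c′ , i∈c′ , shorter) = reduceToGood c′ i∈c′ (smaller shorter)

  module _ (forks : ∀ i → Fork i) where

    successor : Fin t → Fin t
    successor i = proj₁ (fork⇒step (forks i))

    chainFrom : ∀ x m → Chain x (iterate successor x m)
    chainFrom x zero    = []
    chainFrom x (suc m) = proj₂ (fork⇒step (forks x)) ∷ chainFrom (successor x) m

    cycle : Fin t → ∃ λ i → Σ (Chain i i) λ c → i ∈ starts c
    cycle x₀ with periodicPoint successor x₀
    ... | x , m , closes =
      x , subst (λ y → Σ (Chain x y) λ c → x ∈ starts c) closes (chainFrom x (suc m) , here refl)

  module NewLinkage {i₀} (c : Chain i₀ i₀) (i₀∈c : i₀ ∈ starts c) (good : Good c) where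
    open import Data.List.Membership.DecPropositional (_≟_ {t}) using () renaming (_∈?_ to _∈ₜ?_)

    data Fate (x : Fin t) : Set where
      moved : ∀ {k} (s : Step x k) → ⟨ s ⟩ ∈ moves c → Fate x
      stays : x ∉ starts c → Fate x

    fate : ∀ x → Fate x
    fate x with x ∈ₜ? starts c
    ... | no x∉c = stays x∉c
    ... | yes x∈c with ∈-map⁻ Move.from x∈c
    ...   | ⟨ s ⟩ , s∈c , refl = moved s s∈c

    via : ∀ {x} → Fate x → Fin t
    via (moved {k} _ _) = k
    via {x} (stays _)   = x

    fateOffs : ∀ {x} → Fate x → List (Fin n)
    fateOffs (moved s _) = stepOffs s
    fateOffs (stays _)   = []

    route : ∀ {x} (f : Fate x) → Walk G (α x) (β (σ (via f)))
    route (moved s _)     = reroute s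
    route {x} (stays _)   = path x

    route-unique : ∀ {x} (f : Fate x) → Unique (verts G (route f))
    route-unique (moved s _)   = reroute-unique s
    route-unique {x} (stays _) = isPath x

    route-verts : ∀ {x v} (f : Fate x) → v ∈ verts G (route f) → v ∈ fateOffs f ⊎ RouteVertex x (via f) v
    route-verts (moved s _) v∈ = reroute-verts s v∈
    route-verts (stays _)   v∈ = inj₂ (path-verts v∈)

    fateOffs-offP : ∀ {x v} (f : Fate x) → v ∈ fateOffs f → OffP v
    fateOffs-offP (moved (step _ _ d) _) = offs-offP d
    fateOffs-offP (stays _)              ()

    -- The chain is closed, so the path a detour lands on is itself rerouted.
    moved-via-∈ : ∀ {x k} {s : Step x k} → ⟨ s ⟩ ∈ moves c → k ∈ starts c
    moved-via-∈ s∈c = Sum.[ id , (λ { refl → i₀∈c }) ] (to-∈-starts c s∈c)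

    fates-compatible : ∀ {x x′} → x ≢ x′ → (f : Fate x) (f′ : Fate x′) →
                       via f ≢ via f′ × Disjoint (fateOffs f) (fateOffs f′)
    fates-compatible x≢x′ (moved s s∈c) (moved s′ s′∈c) =
      let compatible k≢k′ disj =
            allPairs-lookup compatible-sym good s∈c s′∈c (x≢x′ ∘ cong Move.from)
      in k≢k′ , disj
    fates-compatible x≢x′ (moved s s∈c) (stays x′∉c) =
      (λ { refl → x′∉c (moved-via-∈ s∈c) }) , λ ()
    fates-compatible x≢x′ (stays x∉c) (moved s′ s′∈c) =
      (λ { refl → x∉c (moved-via-∈ s′∈c) }) , λ ()
    fates-compatible x≢x′ (stays _) (stays _) = x≢x′ , λ ()

    routes-disjoint : ∀ {x x′} → x ≢ x′ → (f : Fate x) (f′ : Fate x′) →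
                      ∀ v → v ∈ verts G (route f) → v ∉ verts G (route f′)
    routes-disjoint x≢x′ f f′ v v∈f v∈f′
      with fates-compatible x≢x′ f f′ | route-verts f v∈f | route-verts f′ v∈f′
    ... | _ , disj     | inj₁ v∈offs | inj₁ v∈offs′ = disj (v∈offs , v∈offs′)
    ... | _            | inj₁ v∈offs | inj₂ onRoute′ = fateOffs-offP f v∈offs (routeVertex-onP onRoute′)
    ... | _            | inj₂ onRoute | inj₁ v∈offs′ = fateOffs-offP f′ v∈offs′ (routeVertex-onP onRoute)
    ... | via≢via′ , _ | inj₂ onRoute | inj₂ onRoute′ =
      routeVertices-disjoint x≢x′ via≢via′ onRoute onRoute′

    σ′ : Fin t → Fin t
    σ′ x = σ (via (fate x))

    σ′-injective : ∀ {x x′} → σ′ x ≡ σ′ x′ → x ≡ x′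
    σ′-injective {x} {x′} σ′x≡σ′x′ with x ≟ x′
    ... | yes x≡x′ = x≡x′
    ... | no x≢x′  = ⊥-elim (proj₁ (fates-compatible x≢x′ (fate x) (fate x′)) (σ-inj σ′x≡σ′x′))

    linkage : Linkage G α β
    linkage = record
      { σ        = σ′
      ; σ-inj    = σ′-injective
      ; path     = λ x → route (fate x)
      ; isPath   = λ x → route-unique (fate x)
      ; disjoint = λ x x′ x≢x′ → routes-disjoint x≢x′ (fate x) (fate x′)
      }

    freshEdge : ∀ {x} (f : Fate x) → x ∈ starts c → ∃ λ w → usesEdge G (route f) (α x) w × ¬ InE G P (α x) w
    freshEdge (moved s _)   _   = reroute-freshEdge s
    freshEdge (stays x∉c) x∈c = ⊥-elim (x∉c x∈c)

    ¬rigid : ¬ Rigid G P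
    ¬rigid rigid with freshEdge (fate i₀) i₀∈c
    ... | w , uses , ¬inP = ¬inP (proj₁ (proj₂ (rigid linkage) (α i₀) w) (i₀ , uses))

  forks⇒¬rigid : (∀ i → Fork i) → Fin t → ¬ Rigid G P
  forks⇒¬rigid forks x₀ with cycle forks x₀
  ... | _ , c , i∈c with reduceToGood c i∈c (<-wellFounded (size c))
  ...   | c′ , i∈c′ , good = NewLinkage.¬rigid c′ i∈c′ good

  someOneNeighbourOutside : Rigid G P → Fin t → ∃ λ i → OneNeighbourOutside G α (α i)
  someOneNeighbourOutside rigid x₀ with all? (λ i → anotherNeighbourOutside? (α i) (next i))
  ... | yes forks = ⊥-elim (forks⇒¬rigid forks x₀ rigid)
  ... | no ¬forks =
    let i , ¬fork = ¬∀⟶∃¬ t Fork (λ i → anotherNeighbourOutside? (α i) (next i)) ¬forks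
    in i , oneNeighbourOutside (next-adj i) (next-∉α i) ¬fork

lemma2p8 : ∀ {n t : ℕ} (G : Graph n) (α β : Fin t → Fin n) →
    1 ≤ n →
    ComponentsMeet G α β →
    (P : Linkage G α β) →
    (∀ i → Linkage.σ P i ≡ i) →
    (∀ i → α i ≢ β i) →
    Rigid G P →
    ∃ λ i → OneNeighbourOutside G α (α i)
lemma2p8 {zero}  _ _ _ () _ _ _ _ _
lemma2p8 {suc n} G α β _ meets P σ-id nontrivial rigid =
  someOneNeighbourOutside rigid (someIndex zero)
  where open Rerouting G meets P σ-id nontrivial
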